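{- Let $t,\lambda,k,n$ be positive integers. If there exists a $k$-diregular $(t,\lambda)$-liking digraph with $n$ vertices, then there exists a symmetric $t$-$(n,k,\lambda)$ design.
   Context: All digraphs are finite and have no loops and no multiple arcs. A digraph $D$ is a $(t,\lambda)$-liking digraph if every set of $t$ distinct vertices of $D$ has exactly $\lambda$ common out-neighbors (the definition presumes $D$ has at least $t$ vertices). A digraph is $k$-diregular if every vertex has out-degree $k$ and in-degree $k$. For positive integers $v>k\ge t$ and $\lambda$, a $t$-$(v,k,\lambda)$ design is a pair $(X,\mathcal{B})$ where $X$ is a set of $v$ elements (varieties) and $\mathcal{B}$ is a collection of $k$-element subsets of $X$ (blocks) such that every $t$-element subset of $X$ is contained in exactly $\lambda$ blocks. It is symmetric if the number of blocks equals the number of varieties, i.e. $v=\lambda\binom{v}{t}/\binom{k}{t}$. -}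

module Defs where

open import Data.Nat using (ℕ; _<_; _≤_)
open import Data.Bool using (Bool; true; false; _∧_; _∨_; not)
open import Data.Fin using (Fin)
open import Data.Fin.Subset using (Subset; ∣_∣)
open import Data.Vec using (Vec; tabulate; lookup; foldr)
open import Data.Vec as V using ()
open import Data.Product using (_×_; Σ)
open import Relation.Binary.PropositionalEquality using (_≡_)

-- A finite digraph on vertex set Fin n, without loops; arcs given by a
-- Boolean adjacency relation (so no multiple arcs).  adj u v = true means u → v.
record Digraph (n : ℕ) : Set where
  field
    adj      : Fin n → Fin n → Bool
    loopless : ∀ v → adj v v ≡ false
open Digraph public

outNbrs : ∀ {n} → Digraph n → Fin n → Subset n
outNbrs D u = tabulate (λ w → adj D u w)

inNbrs : ∀ {n} → Digraph n → Fin n → Subset n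
inNbrs D w = tabulate (λ u → adj D u w)

IsDiregular : ∀ {n} → ℕ → Digraph n → Set
IsDiregular k D = ∀ v → ∣ outNbrs D v ∣ ≡ k × ∣ inNbrs D v ∣ ≡ k

allF : ∀ {n} → (Fin n → Bool) → Bool
allF {n} f = foldr _ _∧_ true (tabulate f)

isSubsetOf : ∀ {n} → Subset n → Subset n → Bool
isSubsetOf S T = allF (λ u → not (lookup S u) ∨ lookup T u)

commonOut : ∀ {n} → Digraph n → Subset n → Subset n
commonOut D S = tabulate (λ w → isSubsetOf S (inNbrs D w))

IsLiking : ∀ {n} → ℕ → ℕ → Digraph n → Set
IsLiking {n} t lam D =
  t ≤ n × (∀ (S : Subset n) → ∣ S ∣ ≡ t → ∣ commonOut D S ∣ ≡ lam)

-- t-(v,k,λ) design with b blocks: varieties Fin v, blocks an indexed family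
-- (collection, repetitions allowed) of k-subsets.
record Design (t v k lam b : ℕ) : Set where
  field
    block     : Fin b → Subset v
    blockSize : ∀ i → ∣ block i ∣ ≡ k
    balanced  : ∀ (T : Subset v) → ∣ T ∣ ≡ t →
                ∣ tabulate (λ i → isSubsetOf T (block i)) ∣ ≡ lam
open Design public

DesignParams : ℕ → ℕ → ℕ → ℕ → Set
DesignParams t v k lam = 0 < t × t ≤ k × k < v × 0 < lam

IsDesign : ℕ → ℕ → ℕ → ℕ → ℕ → Set
IsDesign t v k lam b = DesignParams t v k lam × Design t v k lam b

SymmetricDesign : ℕ → ℕ → ℕ → ℕ → Set
SymmetricDesign t v k lam = IsDesign t v k lam v

{-# OPTIONS --safe #-}
-- The in-neighbourhoods of the vertices are the blocks: a t-set S lies in the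
-- in-neighbourhood of w exactly when w is a common out-neighbour of S, so every
-- t-set lies in exactly λ blocks, and there are n blocks of size k.  The
-- parameter conditions come for free: k < n because no vertex is its own
-- in-neighbour, and t ≤ k because some t-set has λ > 0 common out-neighbours,
-- each of whose in-neighbourhoods contains it.
module Submission where

open import Defs
open import Data.Nat using (ℕ; _<_; _≤_; suc; z≤n; s≤s)
open import Data.Nat.Properties using (<-irrefl)
open import Data.Product using (Σ; _×_; _,_; proj₂)
open import Data.Bool using (Bool; true; not; _∨_)
open import Data.Bool.Properties using (∧-conicalˡ; ∧-conicalʳ)
open import Data.Fin using (Fin; zero; suc)
open import Data.Fin.Subset using (Subset; ∣_∣; _∈_; _∉_; _⊆_; ⊥; Nonempty; inside)
open import Data.Fin.Subset.Properties
  using (∈⊤; ⊆⊤; ∣⊤∣≡n; ∣⊥∣≡0; p⊂q⇒∣p∣<∣q∣; p⊆q⇒∣p∣≤∣q∣; nonempty?; Empty-unique)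
open import Data.Vec using (_∷_; lookup)
open import Data.Vec.Properties using ([]=⇒lookup; lookup⇒[]=; lookup∘tabulate)
open import Relation.Binary.PropositionalEquality using (_≡_; refl; sym; trans; cong; subst; subst₂)
open import Relation.Nullary using (yes; no)
open import Data.Empty using (⊥-elim)

allF⇒∀ : ∀ {n} (f : Fin n → Bool) → allF f ≡ true → ∀ i → f i ≡ true
allF⇒∀ f all≡true zero    = ∧-conicalˡ (f zero) _ all≡true
allF⇒∀ f all≡true (suc i) = allF⇒∀ (λ j → f (suc j)) (∧-conicalʳ (f zero) _ all≡true) i

isSubsetOf⇒⊆ : ∀ {n} (S T : Subset n) → isSubsetOf S T ≡ true → S ⊆ T
isSubsetOf⇒⊆ S T S⊆ᵇT {x} x∈S =
  lookup⇒[]= x T (implies (lookup S x) ([]=⇒lookup x∈S) (allF⇒∀ _ S⊆ᵇT x))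
  where
  implies : ∀ a {b} → a ≡ true → not a ∨ b ≡ true → b ≡ true
  implies true refl b≡true = b≡true

x∉p⇒∣p∣<n : ∀ {n} {p : Subset n} {x : Fin n} → x ∉ p → ∣ p ∣ < n
x∉p⇒∣p∣<n {n} {p} {x} x∉p = subst (∣ p ∣ <_) (∣⊤∣≡n n) (p⊂q⇒∣p∣<∣q∣ {p = p} (⊆⊤ , x , ∈⊤ , x∉p))

∣p∣>0⇒Nonempty : ∀ {n} (p : Subset n) → 0 < ∣ p ∣ → Nonempty p
∣p∣>0⇒Nonempty {n} p ∣p∣>0 with nonempty? p
... | yes p≢∅ = p≢∅
... | no  p≡∅ = ⊥-elim (<-irrefl refl
                  (subst (0 <_) (trans (cong ∣_∣ (Empty-unique p≡∅)) (∣⊥∣≡0 n)) ∣p∣>0))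

subsetOfSize : ∀ {t n} → t ≤ n → Σ (Subset n) (λ S → ∣ S ∣ ≡ t)
subsetOfSize {n = n} z≤n = ⊥ , ∣⊥∣≡0 n
subsetOfSize (s≤s t≤n) with S , ∣S∣≡t ← subsetOfSize t≤n = inside ∷ S , cong suc ∣S∣≡t

module _ {n : ℕ} (D : Digraph n) where

  ∈inNbrs⇒adj : ∀ {u w} → u ∈ inNbrs D w → adj D u w ≡ true
  ∈inNbrs⇒adj {u} {w} u∈ = trans (sym (lookup∘tabulate (λ v → adj D v w) u)) ([]=⇒lookup u∈)

  ∉inNbrs-self : ∀ v → v ∉ inNbrs D v
  ∉inNbrs-self v v∈ with () ← trans (sym (∈inNbrs⇒adj v∈)) (loopless D v)

  ∈commonOut⇒⊆inNbrs : ∀ {S w} → w ∈ commonOut D S → S ⊆ inNbrs D w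
  ∈commonOut⇒⊆inNbrs {S} {w} w∈ = isSubsetOf⇒⊆ S (inNbrs D w)
    (trans (sym (lookup∘tabulate (λ v → isSubsetOf S (inNbrs D v)) w)) ([]=⇒lookup w∈))

  diregular⇒k<n : ∀ {k} → IsDiregular k D → Fin n → k < n
  diregular⇒k<n reg v = subst (_< n) (proj₂ (reg v)) (x∉p⇒∣p∣<n (∉inNbrs-self v))

  diregular-liking⇒t≤k : ∀ {t lam k} → 0 < lam →
    IsDiregular k D → IsLiking t lam D → t ≤ k
  diregular-liking⇒t≤k lam>0 reg (t≤n , liking)
    with S , ∣S∣≡t ← subsetOfSize t≤n
    with w , w∈ ← ∣p∣>0⇒Nonempty (commonOut D S) (subst (0 <_) (sym (liking S ∣S∣≡t)) lam>0)
    = subst₂ _≤_ ∣S∣≡t (proj₂ (reg w)) (p⊆q⇒∣p∣≤∣q∣ {p = S} (∈commonOut⇒⊆inNbrs w∈))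

  inNbrsDesign : ∀ {t lam k} → IsDiregular k D → IsLiking t lam D → Design t n k lam n
  inNbrsDesign reg (_ , liking) = record
    { block     = inNbrs D
    ; blockSize = λ v → proj₂ (reg v)
    ; balanced  = liking
    }

lemma2p5 : (t lam k n : ℕ) → 0 < t → 0 < lam → 0 < k → 0 < n →
    (Σ (Digraph n) (λ D → IsDiregular k D × IsLiking t lam D)) →
    SymmetricDesign t n k lam
lemma2p5 t lam k (suc n) t>0 lam>0 _ _ (D , reg , liking) =
  (t>0 , diregular-liking⇒t≤k D lam>0 reg liking , diregular⇒k<n D reg zero , lam>0)
  , inNbrsDesign D reg liking
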